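{- Let $x$ be a dyadic rational with $x\ge0$. Then there exists a tower $T$ with $T=x$ such that every story $S$ of $T$ satisfies $S\ge0$.
   Context: Games are short normal-play combinatorial games with the usual disjunctive sum, order and equality; short numbers have dyadic rational values. The ordinal sum is $G\mathbin{:}H\cong\{L(G),G\mathbin{:}H^L\mid R(G),G\mathbin{:}H^R\}$, and $\bigodot_{i=1}^n G_i$ denotes $G_1\mathbin{:}G_2\mathbin{:}\cdots\mathbin{:}G_n$. A tower is a game of the form $T=\bigodot_{i=1}^n(b_i+r_i)$ where each $b_i$ is a non-negative integer in canonical form and each $r_i$ is a non-positive integer in canonical form (canonical integers: $0\cong\{\mid\}$, $k+1\cong\{k\mid\}$, $-k\cong\{\mid-k+1\}$); each $b_i+r_i$ is a story of $T$. -}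

module Defs where

open import Data.Nat using (ℕ; zero; suc; _+_)
open import Data.Fin using (Fin; splitAt)
open import Data.Sum using (inj₁; inj₂; [_,_]′)
open import Data.Product using (_×_; _,_)
open import Data.List using (List; []; _∷_)
open import Data.List.NonEmpty using (List⁺; _∷_)
open import Data.Empty using (⊥)
open import Relation.Nullary using (¬_)

data Game : Set where
  mk : (nL : ℕ) → (Fin nL → Game) → (nR : ℕ) → (Fin nR → Game) → Game

zeroG : Game
zeroG = mk 0 (λ ()) 0 (λ ())

_≤G_ : Game → Game → Set
mk gl GL gr GR ≤G mk hl HL hr HR =
  ((i : Fin gl) → ¬ (mk hl HL hr HR ≤G GL i)) ×
  ((j : Fin hr) → ¬ (HR j ≤G mk gl GL gr GR))

_≈G_ : Game → Game → Set
G ≈G H = (G ≤G H) × (H ≤G G)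

_+G_ : Game → Game → Game
G@(mk gl GL gr GR) +G H@(mk hl HL hr HR) =
  mk (gl + hl)
     (λ k → [ (λ i → GL i +G H) , (λ j → G +G HL j) ]′ (splitAt gl k))
     (gr + hr)
     (λ k → [ (λ i → GR i +G H) , (λ j → G +G HR j) ]′ (splitAt gr k))

_⊙_ : Game → Game → Game
G@(mk gl GL gr GR) ⊙ mk hl HL hr HR =
  mk (gl + hl)
     (λ k → [ GL , (λ j → G ⊙ HL j) ]′ (splitAt gl k))
     (gr + hr)
     (λ k → [ GR , (λ j → G ⊙ HR j) ]′ (splitAt gr k))

posInt : ℕ → Game
posInt zero = zeroG
posInt (suc k) = mk 1 (λ _ → posInt k) 0 (λ ())

negInt : ℕ → Game
negInt zero = zeroG
negInt (suc k) = mk 0 (λ ()) 1 (λ _ → negInt k)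

-- A story b + r with b ≥ 0, r ≤ 0; the pair (b , r') encodes b + (-r').
story : ℕ × ℕ → Game
story (b , r) = posInt b +G negInt r

-- A tower is given by its nonempty list of stories (b₁,r₁),…,(bₙ,rₙ), n ≥ 1;
-- its value is the ordinal sum S₁ : (S₂ : ( … : Sₙ)).
towerAux : ℕ × ℕ → List (ℕ × ℕ) → Game
towerAux s [] = story s
towerAux s (t ∷ ts) = story s ⊙ towerAux t ts

tower : List⁺ (ℕ × ℕ) → Game
tower (s ∷ ss) = towerAux s ss

halfPow : ℕ → Game
halfPow zero = posInt 1
halfPow (suc k) = mk 1 (λ _ → zeroG) 1 (λ _ → halfPow k)

-- The non-negative dyadic rational m/2^k as a game: m copies of 1/2^k.
dyadic : ℕ → ℕ → Game
dyadic zero k = zeroG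
dyadic (suc m) k = halfPow k +G dyadic m k

-- Write x = m / 2^k. Its tower starts with the story (⌊m/2^k⌋ + 1) − 1 and then appends,
-- for each of the k binary digits of m below that, the story 1 (digit 1) or 1 − 1 (digit 0);
-- all these stories are ≥ 0. If the best options of a number G are G ∓ 2^-d, then
-- G : 1 = { G^L, G | G^R } is G + 2^-(d+1), and G : (1 − 1) = { G^L, G : −1 | G^R, G : 1 } is
-- G again, in both cases with best options at distance 2^-(d+1); so the tower is the number x.
-- The sum of m copies of 1/2^k is a number of the same value, and numbers are compared by value.
module Submission where

open import Defs
open import Data.Nat as ℕ using (ℕ; zero; suc; _⊓_; ⌊_/2⌋; z≤n; s≤s)
import Data.Nat.Properties as ℕ
open import Data.Integer using (ℤ; +_; +<+; +≤+; _+_; _-_; _*_; -_; _≤_; _<_; 0ℤ; 1ℤ; NonNegative)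
open import Data.Integer.Properties
open import Data.Integer.Divisibility.Signed using (_∣_; divides; ∣-refl; ∣-trans; ∣m∣n⇒∣m+n; ∣m+n∣n⇒∣m)
open import Data.Integer.Tactic.RingSolver using (solve-∀)
open import Data.Fin using (Fin; zero; splitAt; _↑ˡ_; _↑ʳ_)
open import Data.Vec.Functional using (Vector; _++_; map)
open import Data.Vec.Functional.Properties using (lookup-++ˡ; lookup-++ʳ)
open import Data.Sum using (_⊎_; inj₁; inj₂; [_,_])
open import Data.Product using (Σ; _×_; _,_; ∃-syntax; proj₁; proj₂)
open import Data.List as List using ([]; _∷_)
open import Data.List.NonEmpty using (List⁺; _∷_; _⁺∷ʳ_; toList)
open import Data.List.Relation.Unary.All using (All; []; _∷_)
open import Data.List.Relation.Unary.All.Properties using (∷ʳ⁺)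
open import Data.Empty using (⊥-elim)
open import Function using (id)
open import Relation.Binary.PropositionalEquality
  using (_≡_; refl; subst; subst₂; sym; cong; trans; module ≡-Reasoning)
open import Relation.Nullary using (¬_; yes; no; contradiction)

private
  variable
    a b c m n : ℕ
    A : Set

module _ (P : A → Set) where

  ++-all : (xs : Vector A m) (ys : Vector A n) →
           (∀ i → P (xs i)) → (∀ j → P (ys j)) → ∀ k → P ((xs ++ ys) k)
  ++-all {m = m} xs ys pxs pys k with splitAt m k
  ... | inj₁ i = pxs i
  ... | inj₂ j = pys j

  ++-anyˡ : (xs : Vector A m) (ys : Vector A n) → ∃[ i ] P (xs i) → ∃[ k ] P ((xs ++ ys) k)
  ++-anyˡ {n = n} xs ys (i , pxi) = i ↑ˡ n , subst P (sym (lookup-++ˡ xs ys i)) pxi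

  ++-anyʳ : (xs : Vector A m) (ys : Vector A n) → ∃[ j ] P (ys j) → ∃[ k ] P ((xs ++ ys) k)
  ++-anyʳ {m = m} xs ys (j , pyj) = m ↑ʳ j , subst P (sym (lookup-++ʳ xs ys j)) pyj

_⊆[_]_ : Vector A a → (A → A → Set) → Vector A b → Set
xs ⊆[ R ] ys = ∀ i → ∃[ j ] R (xs i) (ys j)

-- Hypotheses only concern members of the families, so that recursive calls on options made
-- through these lemmas are seen to be structural.
module _ (R : A → A → Set) where

  ⊆-refl : {xs : Vector A a} → (∀ {i} → R (xs i) (xs i)) → xs ⊆[ R ] xs
  ⊆-refl r i = i , r

  ⊆-trans : {xs : Vector A a} {ys : Vector A b} {zs : Vector A c} →
            (∀ {i j k} → R (xs i) (ys j) → R (ys j) (zs k) → R (xs i) (zs k)) →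
            xs ⊆[ R ] ys → ys ⊆[ R ] zs → xs ⊆[ R ] zs
  ⊆-trans t xs⊆ys ys⊆zs i =
    let (j , r) = xs⊆ys i ; (k , s) = ys⊆zs j in k , t r s

  map-⊆ : {xs : Vector A a} {ys : Vector A b} (f g : A → A) →
          (∀ {i j} → R (xs i) (ys j) → R (f (xs i)) (g (ys j))) →
          xs ⊆[ R ] ys → map f xs ⊆[ R ] map g ys
  map-⊆ f g h xs⊆ys i = let (j , r) = xs⊆ys i in j , h r

  map-++-⊆ : {zs : Vector A c} (f : A → A) (xs : Vector A m) (ys : Vector A n) →
             map f xs ⊆[ R ] zs → map f ys ⊆[ R ] zs → map f (xs ++ ys) ⊆[ R ] zs
  map-++-⊆ {zs = zs} f = ++-all (λ x → ∃[ j ] R (f x) (zs j))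

  ⊆-map-++ˡ : {zs : Vector A c} (f : A → A) (xs : Vector A m) (ys : Vector A n) →
              zs ⊆[ R ] map f xs → zs ⊆[ R ] map f (xs ++ ys)
  ⊆-map-++ˡ {zs = zs} f xs ys zs⊆xs i = ++-anyˡ (λ x → R (zs i) (f x)) xs ys (zs⊆xs i)

  ⊆-map-++ʳ : {zs : Vector A c} (f : A → A) (xs : Vector A m) (ys : Vector A n) →
              zs ⊆[ R ] map f ys → zs ⊆[ R ] map f (xs ++ ys)
  ⊆-map-++ʳ {zs = zs} f xs ys zs⊆ys i = ++-anyʳ (λ x → R (zs i) (f x)) xs ys (zs⊆ys i)

nLeft nRight : Game → ℕ
nLeft  (mk n _ _ _) = n
nRight (mk _ _ n _) = n

leftOption : (G : Game) → Fin (nLeft G) → Game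
leftOption (mk _ L _ _) = L

rightOption : (G : Game) → Fin (nRight G) → Game
rightOption (mk _ _ _ R) = R

≤G⇒¬≤G-leftOption : ∀ {G H} → G ≤G H → ∀ i → ¬ (H ≤G leftOption G i)
≤G⇒¬≤G-leftOption {mk _ _ _ _} {mk _ _ _ _} = proj₁

≤G⇒¬rightOption-≤G : ∀ {G H} → G ≤G H → ∀ j → ¬ (rightOption H j ≤G G)
≤G⇒¬rightOption-≤G {mk _ _ _ _} {mk _ _ _ _} = proj₂

≤G-refl : ∀ {G} → G ≤G G
≤G-refl {mk _ _ _ _} =
  (λ i G≤GL → ≤G⇒¬≤G-leftOption G≤GL i ≤G-refl) ,
  (λ j GR≤G → ≤G⇒¬rightOption-≤G GR≤G j ≤G-refl)

≤G-trans : ∀ {G H K} → G ≤G H → H ≤G K → G ≤G K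
≤G-trans {mk _ _ _ _} {mk _ _ _ _} {mk _ _ _ _} G≤H H≤K =
  (λ i K≤GL → proj₁ G≤H i (≤G-trans H≤K K≤GL)) ,
  (λ j KR≤G → proj₂ H≤K j (≤G-trans KR≤G G≤H))

≈G-trans : ∀ {G H K} → G ≈G H → H ≈G K → G ≈G K
≈G-trans (G≤H , H≤G) (H≤K , K≤H) = ≤G-trans G≤H H≤K , ≤G-trans K≤H H≤G

-- Bisimilar games

infix 4 _∼_

-- GL ⊆[ _∼_ ] HL × HL ⊆[ _∼_ ] GL × GR ⊆[ _∼_ ] HR × HR ⊆[ _∼_ ] GR, unfolded for termination.
_∼_ : Game → Game → Set
mk _ GL _ GR ∼ mk _ HL _ HR =
  (∀ i → ∃[ j ] GL i ∼ HL j) × (∀ j → ∃[ i ] HL j ∼ GL i) ×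
  (∀ i → ∃[ j ] GR i ∼ HR j) × (∀ j → ∃[ i ] HR j ∼ GR i)

∼-refl : ∀ {G} → G ∼ G
∼-refl {mk _ _ _ _} = ⊆-refl _∼_ ∼-refl , ⊆-refl _∼_ ∼-refl , ⊆-refl _∼_ ∼-refl , ⊆-refl _∼_ ∼-refl

∼-sym : ∀ {G H} → G ∼ H → H ∼ G
∼-sym {mk _ _ _ _} {mk _ _ _ _} (l , l′ , r , r′) = l′ , l , r′ , r

∼-trans : ∀ {G H K} → G ∼ H → H ∼ K → G ∼ K
∼-trans {mk _ _ _ _} {mk _ _ _ _} {mk _ _ _ _} (l₁ , l₁′ , r₁ , r₁′) (l₂ , l₂′ , r₂ , r₂′) =
  ⊆-trans _∼_ ∼-trans l₁ l₂ , ⊆-trans _∼_ ∼-trans l₂′ l₁′ ,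
  ⊆-trans _∼_ ∼-trans r₁ r₂ , ⊆-trans _∼_ ∼-trans r₂′ r₁′

∼⇒≤G : ∀ {G H} → G ∼ H → G ≤G H
∼⇒≤G {G@(mk _ _ _ _)} {H@(mk _ _ _ _)} (l , _ , _ , r′) =
  (λ i H≤GL → let (j , GL∼HL) = l i in
     ≤G⇒¬≤G-leftOption (≤G-refl {H}) j (≤G-trans H≤GL (∼⇒≤G GL∼HL))) ,
  (λ j HR≤G → let (i , HR∼GR) = r′ j in
     ≤G⇒¬rightOption-≤G (≤G-refl {G}) i (≤G-trans (∼⇒≤G (∼-sym HR∼GR)) HR≤G))

∼⇒≈G : ∀ {G H} → G ∼ H → G ≈G H
∼⇒≈G G∼H = ∼⇒≤G G∼H , ∼⇒≤G (∼-sym G∼H)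

⊙-cong : ∀ {G G′ H H′} → G ∼ G′ → H ∼ H′ → G ⊙ H ∼ G′ ⊙ H′
⊙-cong {G@(mk _ GL _ GR)} {G′@(mk _ GL′ _ GR′)} {mk _ HL _ HR} {mk _ HL′ _ HR′}
       G∼G′@(l , l′ , r , r′) (hl , hl′ , hr , hr′) =
  options GL GL′ HL HL′ G∼G′ l hl , options GL′ GL HL′ HL (∼-sym G∼G′) l′ hl′ ,
  options GR GR′ HR HR′ G∼G′ r hr , options GR′ GR HR′ HR (∼-sym G∼G′) r′ hr′
  where
  options : ∀ {a a′ b b′} {X Y} (xs : Vector Game a) (xs′ : Vector Game a′)
            (ys : Vector Game b) (ys′ : Vector Game b′) → X ∼ Y →
            xs ⊆[ _∼_ ] xs′ → ys ⊆[ _∼_ ] ys′ →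
            (xs ++ map (X ⊙_) ys) ⊆[ _∼_ ] (xs′ ++ map (Y ⊙_) ys′)
  options {X = X} {Y} xs xs′ ys ys′ X∼Y xs⊆ ys⊆ =
    map-++-⊆ _∼_ id xs _ (⊆-map-++ˡ _∼_ id xs′ _ xs⊆)
      (⊆-map-++ʳ _∼_ id xs′ _ (map-⊆ _∼_ (X ⊙_) (Y ⊙_) (⊙-cong X∼Y) ys⊆))

⊙-assoc : ∀ {G H K} → G ⊙ (H ⊙ K) ∼ (G ⊙ H) ⊙ K
⊙-assoc {G@(mk _ GL _ GR)} {H@(mk _ HL _ HR)} {mk _ KL _ KR} =
  forward GL HL KL , backward GL HL KL , forward GR HR KR , backward GR HR KR
  where
  forward : ∀ {a b c} (xs : Vector Game a) (ys : Vector Game b) (zs : Vector Game c) →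
            (xs ++ map (G ⊙_) (ys ++ map (H ⊙_) zs))
              ⊆[ _∼_ ] ((xs ++ map (G ⊙_) ys) ++ map ((G ⊙ H) ⊙_) zs)
  forward xs ys zs =
    map-++-⊆ _∼_ id xs _
      (⊆-map-++ˡ _∼_ id _ _ (⊆-map-++ˡ _∼_ id _ _ (⊆-refl _∼_ ∼-refl)))
      (map-++-⊆ _∼_ (G ⊙_) ys _
        (⊆-map-++ˡ _∼_ id _ _ (⊆-map-++ʳ _∼_ id xs _ (⊆-refl _∼_ ∼-refl)))
        (⊆-map-++ʳ _∼_ id (xs ++ map (G ⊙_) ys) _ (λ l → l , ⊙-assoc)))
  backward : ∀ {a b c} (xs : Vector Game a) (ys : Vector Game b) (zs : Vector Game c) →
             ((xs ++ map (G ⊙_) ys) ++ map ((G ⊙ H) ⊙_) zs)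
               ⊆[ _∼_ ] (xs ++ map (G ⊙_) (ys ++ map (H ⊙_) zs))
  backward xs ys zs =
    map-++-⊆ _∼_ id (xs ++ map (G ⊙_) ys) _
      (map-++-⊆ _∼_ id xs _ (⊆-map-++ˡ _∼_ id xs _ (⊆-refl _∼_ ∼-refl))
        (⊆-map-++ʳ _∼_ id xs _ (⊆-map-++ˡ _∼_ (G ⊙_) ys _ (⊆-refl _∼_ ∼-refl))))
      (⊆-map-++ʳ _∼_ id xs _ (⊆-map-++ʳ _∼_ (G ⊙_) ys _ (λ l → l , ∼-sym ⊙-assoc)))

i<i+j : ∀ {i j} → 0ℤ < j → i < i + j
i<i+j {i} {j} 0<j = subst (_< i + j) (+-identityʳ i) (+-monoʳ-< i 0<j)

+-cancelʳ-≤ : ∀ {i j} k → i + k ≤ j + k → i ≤ j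
+-cancelʳ-≤ {i} {j} k i+k≤j+k = begin
  i          ≡⟨ i+k-k≡i i k ⟨
  i + k - k  ≤⟨ +-monoˡ-≤ (- k) i+k≤j+k ⟩
  j + k - k  ≡⟨ i+k-k≡i j k ⟩
  j          ∎
  where
  open ≤-Reasoning
  i+k-k≡i : ∀ i k → i + k - k ≡ i
  i+k-k≡i = solve-∀

≤+-monoˡ : ∀ {x y d} z → x ≤ y + d → x + z ≤ y + z + d
≤+-monoˡ {x} {y} {d} z x≤y+d = begin
  x + z      ≤⟨ +-monoˡ-≤ z x≤y+d ⟩
  y + d + z  ≡⟨ +-right-comm y d z ⟩
  y + z + d  ∎
  where
  open ≤-Reasoning
  +-right-comm : ∀ y d z → y + d + z ≡ y + z + d
  +-right-comm = solve-∀

≤+-monoʳ : ∀ {x y d} z → x ≤ y + d → z + x ≤ z + y + d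
≤+-monoʳ {x} {y} {d} z x≤y+d = begin
  z + x        ≤⟨ +-monoʳ-≤ z x≤y+d ⟩
  z + (y + d)  ≡⟨ +-assoc z y d ⟨
  z + y + d    ∎
  where open ≤-Reasoning

0<i+j⇒0<i⊎0<j : ∀ {i j} → 0ℤ < i + j → 0ℤ < i ⊎ 0ℤ < j
0<i+j⇒0<i⊎0<j {i} {j} 0<i+j with 0ℤ <? i | 0ℤ <? j
... | yes 0<i | _       = inj₁ 0<i
... | no _    | yes 0<j = inj₂ 0<j
... | no 0≮i  | no 0≮j  = contradiction 0<i+j (≤⇒≯ (+-mono-≤ (≮⇒≥ 0≮i) (≮⇒≥ 0≮j)))

i+j<0⇒i<0⊎j<0 : ∀ {i j} → i + j < 0ℤ → i < 0ℤ ⊎ j < 0ℤ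
i+j<0⇒i<0⊎j<0 {i} {j} i+j<0 with i <? 0ℤ | j <? 0ℤ
... | yes i<0 | _       = inj₁ i<0
... | no _    | yes j<0 = inj₂ j<0
... | no i≮0  | no j≮0  = contradiction i+j<0 (≤⇒≯ (+-mono-≤ (≮⇒≥ i≮0) (≮⇒≥ j≮0)))

∣-<⇒+≤ : ∀ {i j} d .{{_ : NonNegative d}} → d ∣ i → d ∣ j → i < j → i + d ≤ j
∣-<⇒+≤ d (divides a refl) (divides b refl) ad<bd = begin
  a * d + d     ≡⟨ +-comm (a * d) d ⟩
  d + a * d     ≡⟨ suc-* a d ⟨
  (1ℤ + a) * d  ≤⟨ *-monoʳ-≤-nonNeg d (i<j⇒suc[i]≤j (*-cancelʳ-<-nonNeg {a} {b} d ad<bd)) ⟩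
  b * d         ∎
  where open ≤-Reasoning

2^_ : ℕ → ℤ
2^ p = + (2 ℕ.^ p)

0<2^ : ∀ p → 0ℤ < 2^ p
0<2^ p = +<+ (ℕ.m^n>0 2 p)

2^-suc : ∀ p → 2^ suc p ≡ 2^ p + 2^ p
2^-suc p = trans (cong (λ x → + (2 ℕ.^ p ℕ.+ x)) (ℕ.+-identityʳ (2 ℕ.^ p))) (pos-+ (2 ℕ.^ p) (2 ℕ.^ p))

+2^-suc : ∀ x d → x + 2^ suc d ≡ x + 2^ d + 2^ d
+2^-suc x d = trans (cong (_+_ x) (2^-suc d)) (sym (+-assoc x (2^ d) (2^ d)))

+2^-suc-weaken : ∀ {x y} d → x + 2^ suc d ≤ y → x + 2^ d ≤ y
+2^-suc-weaken {x} {y} d x+2^[1+d]≤y =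
  ≤-trans (i≤i+j (x + 2^ d) (2^ d)) (subst (_≤ y) (+2^-suc x d) x+2^[1+d]≤y)

2^-∣ : ∀ {p q} → q ℕ.≤ p → 2^ q ∣ 2^ p
2^-∣ {p} {q} q≤p = divides (2^ (p ℕ.∸ q)) (begin
  2^ p                             ≡⟨ cong 2^_ (ℕ.m+[n∸m]≡n q≤p) ⟨
  2^ (q ℕ.+ (p ℕ.∸ q))             ≡⟨ cong +_ (ℕ.^-distribˡ-+-* 2 q (p ℕ.∸ q)) ⟩
  + (2 ℕ.^ q ℕ.* 2 ℕ.^ (p ℕ.∸ q))  ≡⟨ pos-* (2 ℕ.^ q) _ ⟩
  2^ q * 2^ (p ℕ.∸ q)              ≡⟨ *-comm (2^ q) _ ⟩
  2^ (p ℕ.∸ q) * 2^ q              ∎)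
  where open ≡-Reasoning

2^-suc-∣ : ∀ {d v} → 2^ suc d ∣ v → 2^ d ∣ v
2^-suc-∣ {d} = ∣-trans (2^-∣ (ℕ.n≤1+n d))

2^-∣-gap : ∀ {r p q v w} → r ℕ.≤ p → r ℕ.≤ q → 2^ p ∣ v → 2^ q ∣ w → w < v → w + 2^ r ≤ v
2^-∣-gap {r} {v = v} {w} r≤p r≤q 2^p∣v 2^q∣w =
  ∣-<⇒+≤ {w} {v} (2^ r) (∣-trans (2^-∣ r≤q) 2^q∣w) (∣-trans (2^-∣ r≤p) 2^p∣v)

-- Numbers

NeedsOption : (ℤ → Set) → ℕ → ℤ → ℕ → Set
NeedsOption P N v p = p ℕ.< N ⊎ P v

record NumberWith (N : ℕ) (G : Game) (P : ℤ → Set) : Set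

-- G is a number of value v / 2^N with v a multiple of 2^p. The best options lie within 2^p of v,
-- except that an integer (p = N) needs no option on the side of 0, as in 0 = { | } and 2 = { 1 | }.
record Number (N : ℕ) (G : Game) (v : ℤ) (p : ℕ) : Set where
  inductive
  field
    precision≤ : p ℕ.≤ N
    divisible  : 2^ p ∣ v
    leftBelow  : ∀ i → NumberWith N (leftOption G i) (_< v)
    rightAbove : ∀ j → NumberWith N (rightOption G j) (v <_)
    leftTight  : NeedsOption (0ℤ <_) N v p → ∃[ i ] NumberWith N (leftOption G i) (λ u → v ≤ u + 2^ p)
    rightTight : NeedsOption (_< 0ℤ) N v p → ∃[ j ] NumberWith N (rightOption G j) (_≤ v + 2^ p)

record NumberWith N G P where
  inductive
  pattern
  constructor number
  field
    {value}     : ℤ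
    {precision} : ℕ
    isNumber    : Number N G value precision
    property    : P value

open Number

-- Both values are multiples of the finer grid step 2^r, so w + 2^r ≤ v; the number of precision r
-- has a tight option towards the other one, unless both are integers, and then one of them lies on
-- the side of 0 that requires such an option.
separate : ∀ {N v p w q} → p ℕ.≤ N → q ℕ.≤ N → 2^ p ∣ v → 2^ q ∣ w → w < v →
           NeedsOption (0ℤ <_) N v p × w + 2^ p ≤ v ⊎ NeedsOption (_< 0ℤ) N w q × w + 2^ q ≤ v
separate {N} {v} {p} {w} {q} p≤N q≤N 2^p∣v 2^q∣w w<v with q ℕ.≤? p | q ℕ.<? N | w <? 0ℤ
... | no q≰p  | _       | _       =
  inj₁ (inj₁ (ℕ.<-≤-trans (ℕ.≰⇒> q≰p) q≤N) , 2^-∣-gap ℕ.≤-refl (ℕ.<⇒≤ (ℕ.≰⇒> q≰p)) 2^p∣v 2^q∣w w<v)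
... | yes q≤p | yes q<N | _       = inj₂ (inj₁ q<N , 2^-∣-gap q≤p ℕ.≤-refl 2^p∣v 2^q∣w w<v)
... | yes q≤p | no _    | yes w<0 = inj₂ (inj₂ w<0 , 2^-∣-gap q≤p ℕ.≤-refl 2^p∣v 2^q∣w w<v)
... | yes _   | no q≮N  | no w≮0  =
  inj₁ (inj₂ (≤-<-trans (≮⇒≥ w≮0) w<v) , 2^-∣-gap ℕ.≤-refl (ℕ.≤-trans p≤N (ℕ.≮⇒≥ q≮N)) 2^p∣v 2^q∣w w<v)

number-≤G : ∀ {N G H v p w q} → Number N G v p → Number N H w q → v ≤ w → G ≤G H
number-≰G : ∀ {N G H v p w q} → Number N G v p → Number N H w q → w < v → ¬ (G ≤G H)

number-≤G {G = G@(mk _ GL _ _)} {H = H@(mk _ _ _ HR)} nG nH v≤w =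
  (λ i H≤GL → let number nGL u<v = leftBelow nG i in
     number-≰G {G = H} {H = GL i} nH nGL (<-≤-trans u<v v≤w) H≤GL) ,
  (λ j HR≤G → let number nHR w<u = rightAbove nH j in
     number-≰G {G = HR j} {H = G} nHR nG (≤-<-trans v≤w w<u) HR≤G)

number-≰G {G = G@(mk _ GL _ _)} {H = H@(mk _ _ _ HR)} nG nH w<v G≤H =
  [ (λ (need , w+2^p≤v) → let (i , number nGL v≤u+2^p) = leftTight nG need in
       ≤G⇒¬≤G-leftOption G≤H i
         (number-≤G {G = H} {H = GL i} nH nGL (+-cancelʳ-≤ _ (≤-trans w+2^p≤v v≤u+2^p))))
  , (λ (need , w+2^q≤v) → let (j , number nHR u≤w+2^q) = rightTight nH need in
       ≤G⇒¬rightOption-≤G G≤H j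
         (number-≤G {G = HR j} {H = G} nHR nG (≤-trans u≤w+2^q w+2^q≤v)))
  ] (separate (precision≤ nG) (precision≤ nH) (divisible nG) (divisible nH) w<v)

number-≈G : ∀ {N G H v p q} → Number N G v p → Number N H v q → G ≈G H
number-≈G nG nH = number-≤G nG nH ≤-refl , number-≤G nH nG ≤-refl

-- The tight option of G + H is taken in the summand of finer precision, or, between integers,
-- in one whose value lies on the same side of 0 as the sum.
needsOption-⊓ : ∀ {P : ℤ → Set} {N v w p q} → (P (v + w) → P v ⊎ P w) → p ℕ.≤ N → q ℕ.≤ N →
                NeedsOption P N (v + w) (p ⊓ q) →
                NeedsOption P N v p × p ⊓ q ≡ p ⊎ NeedsOption P N w q × p ⊓ q ≡ q
needsOption-⊓ {N = N} {p = p} {q} split p≤N q≤N need with p ℕ.≤? q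
... | no p≰q = inj₂ (inj₁ (ℕ.<-≤-trans (ℕ.≰⇒> p≰q) p≤N) , ℕ.m≥n⇒m⊓n≡n (ℕ.<⇒≤ (ℕ.≰⇒> p≰q)))
... | yes p≤q with p ℕ.<? N | need
...   | yes p<N | _          = inj₁ (inj₁ p<N , ℕ.m≤n⇒m⊓n≡m p≤q)
...   | no p≮N  | inj₁ p⊓q<N = contradiction (subst (ℕ._< N) (ℕ.m≤n⇒m⊓n≡m p≤q) p⊓q<N) p≮N
...   | no p≮N  | inj₂ P[v+w] =
  [ (λ Pv → inj₁ (inj₂ Pv , ℕ.m≤n⇒m⊓n≡m p≤q))
  , (λ Pw → inj₂ (inj₂ Pw , ℕ.m≥n⇒m⊓n≡n (ℕ.≤-trans q≤N (ℕ.≮⇒≥ p≮N))))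
  ] (split P[v+w])

number-+ : ∀ {N G H v p w q} → Number N G v p → Number N H w q → Number N (G +G H) (v + w) (p ⊓ q)
number-+ {N} {G@(mk _ GL _ GR)} {H@(mk _ HL _ HR)} {v} {p} {w} {q} nG nH = record
  { precision≤ = ℕ.≤-trans (ℕ.m⊓n≤m p q) (precision≤ nG)
  ; divisible  = ∣m∣n⇒∣m+n (∣-trans (2^-∣ (ℕ.m⊓n≤m p q)) (divisible nG))
                           (∣-trans (2^-∣ (ℕ.m⊓n≤n p q)) (divisible nH))
  ; leftBelow  = ++-all (λ X → NumberWith N X (_< v + w)) _ _
      (λ i → let number n u<v = leftBelow nG i in number (number-+ n nH) (+-monoˡ-< w u<v))
      (λ j → let number n u<w = leftBelow nH j in number (number-+ nG n) (+-monoʳ-< v u<w))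
  ; rightAbove = ++-all (λ X → NumberWith N X (v + w <_)) _ _
      (λ i → let number n v<u = rightAbove nG i in number (number-+ n nH) (+-monoˡ-< w v<u))
      (λ j → let number n w<u = rightAbove nH j in number (number-+ nG n) (+-monoʳ-< v w<u))
  ; leftTight  = λ need →
      [ (λ (needG , p⊓q≡p) → let (i , number {u} n v≤u+2^p) = leftTight nG needG in
          ++-anyˡ (λ X → NumberWith N X (λ u → v + w ≤ u + 2^ (p ⊓ q))) _ _
            (i , number (number-+ {G = GL i} n nH)
                        (subst (λ r → v + w ≤ u + w + 2^ r) (sym p⊓q≡p) (≤+-monoˡ {y = u} w v≤u+2^p))))
      , (λ (needH , p⊓q≡q) → let (j , number {u} n w≤u+2^q) = leftTight nH needH in
          ++-anyʳ (λ X → NumberWith N X (λ u → v + w ≤ u + 2^ (p ⊓ q))) _ _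
            (j , number (number-+ {H = HL j} nG n)
                        (subst (λ r → v + w ≤ v + u + 2^ r) (sym p⊓q≡q) (≤+-monoʳ {y = u} v w≤u+2^q))))
      ] (needsOption-⊓ {P = 0ℤ <_} 0<i+j⇒0<i⊎0<j (precision≤ nG) (precision≤ nH) need)
  ; rightTight = λ need →
      [ (λ (needG , p⊓q≡p) → let (i , number {u} n u≤v+2^p) = rightTight nG needG in
          ++-anyˡ (λ X → NumberWith N X (_≤ v + w + 2^ (p ⊓ q))) _ _
            (i , number (number-+ {G = GR i} n nH)
                        (subst (λ r → u + w ≤ v + w + 2^ r) (sym p⊓q≡p) (≤+-monoˡ {y = v} w u≤v+2^p))))
      , (λ (needH , p⊓q≡q) → let (j , number {u} n u≤w+2^q) = rightTight nH needH in
          ++-anyʳ (λ X → NumberWith N X (_≤ v + w + 2^ (p ⊓ q))) _ _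
            (j , number (number-+ {H = HR j} nG n)
                        (subst (λ r → v + u ≤ v + w + 2^ r) (sym p⊓q≡q) (≤+-monoʳ {y = w} v u≤w+2^q))))
      ] (needsOption-⊓ {P = _< 0ℤ} i+j<0⇒i<0⊎j<0 (precision≤ nG) (precision≤ nH) need)
  }

¬needsOption-N : ∀ {P : ℤ → Set} {N v} → ¬ P v → ¬ NeedsOption P N v N
¬needsOption-N ¬Pv = [ ℕ.<-irrefl refl , ¬Pv ]

number-zero : ∀ {N} → Number N zeroG 0ℤ N
number-zero = record
  { precision≤ = ℕ.≤-refl
  ; divisible  = divides 0ℤ refl
  ; leftBelow  = λ ()
  ; rightAbove = λ ()
  ; leftTight  = λ need → ⊥-elim (¬needsOption-N {P = 0ℤ <_} (<-irrefl refl) need)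
  ; rightTight = λ need → ⊥-elim (¬needsOption-N {P = _< 0ℤ} (<-irrefl refl) need)
  }

number-posInt : ∀ N b → Number N (posInt b) (+ b * 2^ N) N
number-posInt N zero    = number-zero
number-posInt N (suc b) = record
  { precision≤ = ℕ.≤-refl
  ; divisible  = divides (+ suc b) refl
  ; leftBelow  = λ _ → number (number-posInt N b) (subst (+ b * 2^ N <_) (step (+ b) (2^ N)) (i<i+j (0<2^ N)))
  ; rightAbove = λ ()
  ; leftTight  = λ _ → zero , number (number-posInt N b) (≤-reflexive (sym (step (+ b) (2^ N))))
  ; rightTight = λ need →
      ⊥-elim (¬needsOption-N {P = _< 0ℤ} (≤⇒≯ (*-monoʳ-≤-nonNeg (2^ N) (+≤+ (z≤n {suc b})))) need)
  }
  where
  step : ∀ x d → x * d + d ≡ (1ℤ + x) * d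
  step = solve-∀

number-negInt : ∀ N r → Number N (negInt r) (- + r * 2^ N) N
number-negInt N zero    = number-zero
number-negInt N (suc r) = record
  { precision≤ = ℕ.≤-refl
  ; divisible  = divides (- + suc r) refl
  ; leftBelow  = λ ()
  ; rightAbove = λ _ → number (number-negInt N r) (subst (- + suc r * 2^ N <_) (step (+ r) (2^ N)) (i<i+j (0<2^ N)))
  ; leftTight  = λ need →
      ⊥-elim (¬needsOption-N {P = 0ℤ <_} (≤⇒≯ (*-monoʳ-≤-nonNeg (2^ N) (neg-≤-pos {suc r} {0}))) need)
  ; rightTight = λ _ → zero , number (number-negInt N r) (≤-reflexive (sym (step (+ r) (2^ N))))
  }
  where
  step : ∀ x d → - (1ℤ + x) * d + d ≡ - x * d
  step = solve-∀

number-story : ∀ N b r → Number N (story (b , r)) ((+ b - + r) * 2^ N) N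
number-story N b r =
  subst₂ (Number N (story (b , r))) (sym (*-distribʳ-+ (2^ N) (+ b) (- + r))) (ℕ.⊓-idem N)
         (number-+ (number-posInt N b) (number-negInt N r))

story-nonneg : ∀ {b r} → r ℕ.≤ b → zeroG ≤G story (b , r)
story-nonneg {b} {r} r≤b =
  number-≤G (number-zero {0}) (number-story 0 b r)
            (subst (0ℤ ≤_) (sym (*-identityʳ (+ b - + r))) (i≤j⇒0≤j-i (+≤+ r≤b)))

number-halfPow : ∀ {N t} k → k ℕ.+ t ≡ N → Number N (halfPow k) (2^ t) t
number-halfPow {N} zero refl =
  subst (λ v → Number N (posInt 1) v N) (*-identityˡ (2^ N)) (number-posInt N 1)
number-halfPow {N} {t} (suc k) k+1+t≡N = record
  { precision≤ = subst (t ℕ.≤_) k+1+t≡N (ℕ.m≤n+m t (suc k))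
  ; divisible  = ∣-refl
  ; leftBelow  = λ _ → number number-zero (0<2^ t)
  ; rightAbove = λ _ → number halfPow-k (subst (2^ t <_) (sym (2^-suc t)) (i<i+j (0<2^ t)))
  ; leftTight  = λ _ → zero , number number-zero (≤-reflexive (sym (+-identityˡ (2^ t))))
  ; rightTight = λ _ → zero , number halfPow-k (≤-reflexive (2^-suc t))
  }
  where
  halfPow-k : Number N (halfPow k) (2^ suc t) (suc t)
  halfPow-k = number-halfPow k (trans (ℕ.+-suc k t) k+1+t≡N)

number-dyadic : ∀ m k → ∃[ p ] Number k (dyadic m k) (+ m) p
number-dyadic zero    k = k , number-zero
number-dyadic (suc m) k =
  let (p , n) = number-dyadic m k in 0 , number-+ (number-halfPow k (ℕ.+-identityʳ k)) n

-- Ordinal sums with the stories 1, −1 and 1 − 1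

record Bracketed (N : ℕ) (G : Game) (v : ℤ) (d : ℕ) : Set where
  field
    precision≤ : d ℕ.≤ N
    divisible  : 2^ d ∣ v
    leftBelow  : ∀ i → NumberWith N (leftOption G i) (λ u → u + 2^ d ≤ v)
    leftAt     : ∃[ i ] NumberWith N (leftOption G i) (λ u → v ≤ u + 2^ d)
    rightAbove : ∀ j → NumberWith N (rightOption G j) (v + 2^ d ≤_)
    rightAt    : ∃[ j ] NumberWith N (rightOption G j) (_≤ v + 2^ d)

module B = Bracketed

bracketed⇒number : ∀ {N G v d} → Bracketed N G v d → Number N G v d
bracketed⇒number {d = d} b = record
  { precision≤ = B.precision≤ b
  ; divisible  = B.divisible b
  ; leftBelow  = λ i → let number n u+2^d≤v = B.leftBelow b i in
                       number n (<-≤-trans (i<i+j (0<2^ d)) u+2^d≤v)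
  ; rightAbove = λ j → let number n v+2^d≤u = B.rightAbove b j in
                       number n (<-≤-trans (i<i+j (0<2^ d)) v+2^d≤u)
  ; leftTight  = λ _ → B.leftAt b
  ; rightTight = λ _ → B.rightAt b
  }

bracketed-⊙-zero : ∀ {N G v d f g} → Bracketed N G v d → Bracketed N (G ⊙ mk 0 f 0 g) v d
bracketed-⊙-zero {N} {mk _ GL _ GR} {v} {d} b = record
  { precision≤ = B.precision≤ b
  ; divisible  = B.divisible b
  ; leftBelow  = ++-all (λ X → NumberWith N X (λ u → u + 2^ d ≤ v)) GL _ (B.leftBelow b) (λ ())
  ; leftAt     = ++-anyˡ (λ X → NumberWith N X (λ u → v ≤ u + 2^ d)) GL _ (B.leftAt b)
  ; rightAbove = ++-all (λ X → NumberWith N X (v + 2^ d ≤_)) GR _ (B.rightAbove b) (λ ())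
  ; rightAt    = ++-anyˡ (λ X → NumberWith N X (_≤ v + 2^ d)) GR _ (B.rightAt b)
  }

bracketed-⊙-one : ∀ {N G v d} → Bracketed N G v (suc d) → Bracketed N (G ⊙ story (1 , 0)) (v + 2^ d) d
bracketed-⊙-one {N} {G@(mk _ GL _ GR)} {v} {d} b = record
  { precision≤ = ℕ.<⇒≤ (B.precision≤ b)
  ; divisible  = ∣m∣n⇒∣m+n (2^-suc-∣ {d} (B.divisible b)) ∣-refl
  ; leftBelow  = ++-all (λ X → NumberWith N X (λ u → u + 2^ d ≤ v + 2^ d)) GL _
      (λ i → let number {u} n u+2^[1+d]≤v = B.leftBelow b i in
             number n (≤-trans (+2^-suc-weaken {u} d u+2^[1+d]≤v) (i≤i+j v (2^ d))))
      (λ { zero → number G⊙0 ≤-refl })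
  ; leftAt     = ++-anyʳ (λ X → NumberWith N X (λ u → v + 2^ d ≤ u + 2^ d)) GL _ (zero , number G⊙0 ≤-refl)
  ; rightAbove = ++-all (λ X → NumberWith N X (v + 2^ d + 2^ d ≤_)) GR _
      (λ j → let number n v+2^[1+d]≤u = B.rightAbove b j in
             number n (subst (_≤ _) (+2^-suc v d) v+2^[1+d]≤u))
      (λ ())
  ; rightAt    = ++-anyˡ (λ X → NumberWith N X (_≤ v + 2^ d + 2^ d)) GR _
      (let (j , number n u≤v+2^[1+d]) = B.rightAt b in
       j , number n (subst (_ ≤_) (+2^-suc v d) u≤v+2^[1+d]))
  }
  where
  G⊙0 : Number N (G ⊙ story (0 , 0)) v (suc d)
  G⊙0 = bracketed⇒number (bracketed-⊙-zero b)

bracketed-⊙-minusOne : ∀ {N G v d} → Bracketed N G (v + 2^ d) (suc d) → Bracketed N (G ⊙ story (0 , 1)) v d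
bracketed-⊙-minusOne {N} {G@(mk _ GL _ GR)} {v} {d} b = record
  { precision≤ = ℕ.<⇒≤ (B.precision≤ b)
  ; divisible  = ∣m+n∣n⇒∣m (2^-suc-∣ {d} (B.divisible b)) ∣-refl
  ; leftBelow  = ++-all (λ X → NumberWith N X (λ u → u + 2^ d ≤ v)) GL _
      (λ i → let number {u} n u+2^[1+d]≤v+2^d = B.leftBelow b i in
             number n (+-cancelʳ-≤ (2^ d) (subst (_≤ v + 2^ d) (+2^-suc u d) u+2^[1+d]≤v+2^d)))
      (λ ())
  ; leftAt     = ++-anyˡ (λ X → NumberWith N X (λ u → v ≤ u + 2^ d)) GL _
      (let (i , number {u} n v+2^d≤u+2^[1+d]) = B.leftAt b in
       i , number n (+-cancelʳ-≤ (2^ d) (subst (v + 2^ d ≤_) (+2^-suc u d) v+2^d≤u+2^[1+d])))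
  ; rightAbove = ++-all (λ X → NumberWith N X (v + 2^ d ≤_)) GR _
      (λ j → let number n v+2^d+2^[1+d]≤u = B.rightAbove b j in
             number n (≤-trans (i≤i+j (v + 2^ d) (2^ d)) (+2^-suc-weaken {v + 2^ d} d v+2^d+2^[1+d]≤u)))
      (λ { zero → number G⊙0 ≤-refl })
  ; rightAt    = ++-anyʳ (λ X → NumberWith N X (_≤ v + 2^ d)) GR _ (zero , number G⊙0 ≤-refl)
  }
  where
  G⊙0 : Number N (G ⊙ story (0 , 0)) (v + 2^ d) (suc d)
  G⊙0 = bracketed⇒number (bracketed-⊙-zero b)

bracketed-⊙-oneMinusOne : ∀ {N G v d} → Bracketed N G v (suc d) → Bracketed N (G ⊙ story (1 , 1)) v d
bracketed-⊙-oneMinusOne {N} {G@(mk _ GL _ GR)} {v} {d} b = record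
  { precision≤ = ℕ.<⇒≤ (B.precision≤ b)
  ; divisible  = 2^-suc-∣ {d} (B.divisible b)
  ; leftBelow  = ++-all (λ X → NumberWith N X (λ u → u + 2^ d ≤ v)) GL _
      (λ i → let number {u} n u+2^[1+d]≤v = B.leftBelow b i in number n (+2^-suc-weaken {u} d u+2^[1+d]≤v))
      (λ { zero → number G⊙-1 (≤-reflexive v-2^d+2^d≡v) })
  ; leftAt     = ++-anyʳ (λ X → NumberWith N X (λ u → v ≤ u + 2^ d)) GL _
      (zero , number G⊙-1 (≤-reflexive (sym v-2^d+2^d≡v)))
  ; rightAbove = ++-all (λ X → NumberWith N X (v + 2^ d ≤_)) GR _
      (λ j → let number n v+2^[1+d]≤u = B.rightAbove b j in number n (+2^-suc-weaken {v} d v+2^[1+d]≤u))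
      (λ { zero → number G⊙1 ≤-refl })
  ; rightAt    = ++-anyʳ (λ X → NumberWith N X (_≤ v + 2^ d)) GR _ (zero , number G⊙1 ≤-refl)
  }
  where
  v-2^d+2^d≡v : v - 2^ d + 2^ d ≡ v
  v-2^d+2^d≡v = i-j+j≡i v (2^ d)
    where
    i-j+j≡i : ∀ i j → i - j + j ≡ i
    i-j+j≡i = solve-∀
  G⊙-1 : Number N (G ⊙ story (0 , 1)) (v - 2^ d) d
  G⊙-1 = bracketed⇒number (bracketed-⊙-minusOne (subst (λ w → Bracketed N G w (suc d)) (sym v-2^d+2^d≡v) b))
  G⊙1 : Number N (G ⊙ story (1 , 0)) (v + 2^ d) d
  G⊙1 = bracketed⇒number (bracketed-⊙-one b)

bracketed-story : ∀ N b r → Bracketed N (story (suc b , suc r)) ((+ b - + r) * 2^ N) N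
bracketed-story N b r = record
  { precision≤ = ℕ.≤-refl
  ; divisible  = divides (+ b - + r) refl
  ; leftBelow  = λ { zero → number (number-story N b (suc r)) (≤-reflexive (down (+ b) (+ r) (2^ N))) }
  ; leftAt     = zero , number (number-story N b (suc r)) (≤-reflexive (sym (down (+ b) (+ r) (2^ N))))
  ; rightAbove = λ { zero → number (number-story N (suc b) r) (≤-reflexive (up (+ b) (+ r) (2^ N))) }
  ; rightAt    = zero , number (number-story N (suc b) r) (≤-reflexive (sym (up (+ b) (+ r) (2^ N))))
  }
  where
  down : ∀ x y e → (x - (1ℤ + y)) * e + e ≡ (x - y) * e
  down = solve-∀
  up : ∀ x y e → (x - y) * e + e ≡ (1ℤ + x - y) * e
  up = solve-∀

-- Towers

digitStory : ℕ → ℕ × ℕ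
digitStory zero          = (1 , 1)
digitStory (suc zero)    = (1 , 0)
digitStory (suc (suc m)) = digitStory m

digitStory-view : ∀ m → digitStory m ≡ (1 , 1) × m ≡ ⌊ m /2⌋ ℕ.+ ⌊ m /2⌋
                      ⊎ digitStory m ≡ (1 , 0) × m ≡ suc (⌊ m /2⌋ ℕ.+ ⌊ m /2⌋)
digitStory-view zero       = inj₁ (refl , refl)
digitStory-view (suc zero) = inj₂ (refl , refl)
digitStory-view (suc (suc m)) with digitStory-view m
... | inj₁ (ds , m≡h+h)   = inj₁ (ds , cong suc (trans (cong suc m≡h+h) (sym (ℕ.+-suc ⌊ m /2⌋ ⌊ m /2⌋))))
... | inj₂ (ds , m≡1+h+h) = inj₂ (ds , cong suc (trans (cong suc m≡1+h+h) (cong suc (sym (ℕ.+-suc ⌊ m /2⌋ ⌊ m /2⌋)))))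

digitStory-nonneg : ∀ m → zeroG ≤G story (digitStory m)
digitStory-nonneg zero          = story-nonneg {1} {1} (s≤s z≤n)
digitStory-nonneg (suc zero)    = story-nonneg {1} {0} z≤n
digitStory-nonneg (suc (suc m)) = digitStory-nonneg m

+h*2^[1+j]≡+[h+h]*2^j : ∀ h j → + h * 2^ suc j ≡ + (h ℕ.+ h) * 2^ j
+h*2^[1+j]≡+[h+h]*2^j h j = begin
  + h * 2^ suc j           ≡⟨ cong (+ h *_) (2^-suc j) ⟩
  + h * (2^ j + 2^ j)      ≡⟨ *-distribˡ-+ (+ h) (2^ j) (2^ j) ⟩
  + h * 2^ j + + h * 2^ j  ≡⟨ *-distribʳ-+ (2^ j) (+ h) (+ h) ⟨
  (+ h + + h) * 2^ j       ≡⟨ cong (_* 2^ j) (pos-+ h h) ⟨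
  + (h ℕ.+ h) * 2^ j       ∎
  where open ≡-Reasoning

+h*2^[1+j]+2^j≡+[1+h+h]*2^j : ∀ h j → + h * 2^ suc j + 2^ j ≡ + suc (h ℕ.+ h) * 2^ j
+h*2^[1+j]+2^j≡+[1+h+h]*2^j h j = begin
  + h * 2^ suc j + 2^ j      ≡⟨ cong (_+ 2^ j) (+h*2^[1+j]≡+[h+h]*2^j h j) ⟩
  + (h ℕ.+ h) * 2^ j + 2^ j  ≡⟨ +-comm (+ (h ℕ.+ h) * 2^ j) (2^ j) ⟩
  2^ j + + (h ℕ.+ h) * 2^ j  ≡⟨ suc-* (+ (h ℕ.+ h)) (2^ j) ⟨
  + suc (h ℕ.+ h) * 2^ j     ∎
  where open ≡-Reasoning

bracketed-⊙-digitStory : ∀ {N G j} m → Bracketed N G (+ ⌊ m /2⌋ * 2^ suc j) (suc j) →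
                         Bracketed N (G ⊙ story (digitStory m)) (+ m * 2^ j) j
bracketed-⊙-digitStory {N} {G} {j} m b with digitStory m | digitStory-view m
... | _ | inj₁ (refl , m≡h+h) =
  subst (λ v → Bracketed N (G ⊙ story (1 , 1)) v j)
        (trans (+h*2^[1+j]≡+[h+h]*2^j ⌊ m /2⌋ j) (cong (λ n → + n * 2^ j) (sym m≡h+h)))
        (bracketed-⊙-oneMinusOne b)
... | _ | inj₂ (refl , m≡1+h+h) =
  subst (λ v → Bracketed N (G ⊙ story (1 , 0)) v j)
        (trans (+h*2^[1+j]+2^j≡+[1+h+h]*2^j ⌊ m /2⌋ j) (cong (λ n → + n * 2^ j) (sym m≡1+h+h)))
        (bracketed-⊙-one b)

towerOf : ℕ → ℕ → List⁺ (ℕ × ℕ)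
towerOf m zero    = (suc m , 1) ∷ []
towerOf m (suc k) = towerOf ⌊ m /2⌋ k ⁺∷ʳ digitStory m

towerGame : ℕ → ℕ → Game
towerGame m zero    = story (suc m , 1)
towerGame m (suc k) = towerGame ⌊ m /2⌋ k ⊙ story (digitStory m)

towerAux-∷ʳ : ∀ s ss t → towerAux s (ss List.∷ʳ t) ∼ towerAux s ss ⊙ story t
towerAux-∷ʳ s []        t = ∼-refl
towerAux-∷ʳ s (s′ ∷ ss) t = ∼-trans (⊙-cong ∼-refl (towerAux-∷ʳ s′ ss t)) ⊙-assoc

tower-⁺∷ʳ : ∀ T t → tower (T ⁺∷ʳ t) ∼ tower T ⊙ story t
tower-⁺∷ʳ (s ∷ ss) t = towerAux-∷ʳ s ss t

tower-towerOf : ∀ m k → tower (towerOf m k) ∼ towerGame m k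
tower-towerOf m zero    = ∼-refl
tower-towerOf m (suc k) =
  ∼-trans (tower-⁺∷ʳ (towerOf ⌊ m /2⌋ k) (digitStory m)) (⊙-cong (tower-towerOf ⌊ m /2⌋ k) ∼-refl)

bracketed-towerGame : ∀ {N j} m k → k ℕ.+ j ≡ N → Bracketed N (towerGame m k) (+ m * 2^ j) j
bracketed-towerGame {N} m zero refl =
  subst (λ v → Bracketed N (story (suc m , 1)) (v * 2^ N) N) (+-identityʳ (+ m)) (bracketed-story N m 0)
bracketed-towerGame {j = j} m (suc k) k+1+j≡N =
  bracketed-⊙-digitStory m (bracketed-towerGame ⌊ m /2⌋ k (trans (ℕ.+-suc k j) k+1+j≡N))

All-⁺∷ʳ : ∀ {P : A → Set} T {t} → All P (toList T) → P t → All P (toList (T ⁺∷ʳ t))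
All-⁺∷ʳ (s ∷ ss) = ∷ʳ⁺

towerOf-nonneg : ∀ m k → All (λ S → zeroG ≤G story S) (toList (towerOf m k))
towerOf-nonneg m zero    = story-nonneg (s≤s z≤n) ∷ []
towerOf-nonneg m (suc k) = All-⁺∷ʳ (towerOf ⌊ m /2⌋ k) (towerOf-nonneg ⌊ m /2⌋ k) (digitStory-nonneg m)

theorem3p4 : (m k : ℕ) →
    Σ (List⁺ (ℕ × ℕ)) λ T →
      (tower T ≈G dyadic m k) × All (λ S → zeroG ≤G story S) (toList T)
theorem3p4 m k =
  towerOf m k ,
  ≈G-trans (∼⇒≈G (tower-towerOf m k)) (number-≈G towerGame-number (proj₂ (number-dyadic m k))) ,
  towerOf-nonneg m k
  where
  towerGame-number : Number k (towerGame m k) (+ m) 0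
  towerGame-number = subst (λ v → Number k (towerGame m k) v 0) (*-identityʳ (+ m))
                           (bracketed⇒number (bracketed-towerGame m k (ℕ.+-identityʳ k)))
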